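{- Let $q$ be an indeterminate and $\mu$ a partition of length $l\ge1$. Then \[ \sum_{c\in C_{\mu}}\prod_{i=1}^{l}\frac{1-q^{(l-i+1)c_i}}{1-q^{[c_i]}}=\frac{l!}{\prod_{i}m_i(\mu)!}. \]
   Context: $C_\mu$ is the set of distinct sequences $c=(c_1,\ldots,c_l)$ obtained by permuting the parts of $\mu$; $[c_i]=c_1+\cdots+c_i$; $m_i(\mu)$ is the multiplicity of $i$ as a part of $\mu$. -}

module Defs where

open import Data.Nat as ℕ using (ℕ; zero; suc; _∸_; _≤_; _≥_)
open import Data.Nat using (_!)
open import Data.List as List using (List; []; _∷_; map; concatMap; length; filter; upTo; deduplicate)
open import Data.List.Properties using (≡-dec)
open import Data.List.Relation.Unary.All using (All)
open import Data.List.Relation.Unary.Linked using (Linked)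
open import Data.Product using (_×_)
open import Data.Integer using (+_)
open import Data.Nat.ListAction using (sum)
open import Data.Rational as ℚ using (ℚ; 0ℚ; 1ℚ; _/_; _+_; _*_; _-_; _÷_; ≢-nonZero)
open import Data.Rational.Properties using (_≟_)
open import Relation.Nullary using (yes; no)

IsPartition : List ℕ → Set
IsPartition μ = All (1 ≤_) μ × Linked _≥_ μ

insertEverywhere : ℕ → List ℕ → List (List ℕ)
insertEverywhere x [] = (x ∷ []) ∷ []
insertEverywhere x (y ∷ ys) = (x ∷ y ∷ ys) ∷ map (y ∷_) (insertEverywhere x ys)

perms : List ℕ → List (List ℕ)
perms [] = [] ∷ []
perms (x ∷ xs) = concatMap (insertEverywhere x) (perms xs)

C : List ℕ → List (List ℕ)
C μ = deduplicate (≡-dec ℕ._≟_) (perms μ)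

_^_ : ℚ → ℕ → ℚ
q ^ zero = 1ℚ
q ^ suc n = q * (q ^ n)

-- division in ℚ (only ever used with nonzero denominators)
_/'_ : ℚ → ℚ → ℚ
p /' r with r ≟ 0ℚ
... | yes _ = 0ℚ
... | no r≢0 = _÷_ p r {{≢-nonZero r≢0}}

sumℚ : List ℚ → ℚ
sumℚ = List.foldr _+_ 0ℚ

prodℚ : List ℚ → ℚ
prodℚ = List.foldr _*_ 1ℚ

-- prodTerms q l acc i c  =  ∏_{j} (1 - q^{(l - (i+j) ) c_j}) / (1 - q^{acc + c_1 + ... + c_j})
-- started with acc = 0, i = 0 this is ∏_{i=1}^{l} (1 - q^{(l-i+1) c_i}) / (1 - q^{[c_i]}).
prodTerms : ℚ → ℕ → ℕ → ℕ → List ℕ → ℚ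
prodTerms q l acc i [] = 1ℚ
prodTerms q l acc i (x ∷ xs) =
  ((1ℚ - q ^ ((l ∸ i) ℕ.* x)) /' (1ℚ - q ^ (acc ℕ.+ x))) * prodTerms q l (acc ℕ.+ x) (suc i) xs

LHS : ℚ → List ℕ → ℚ
LHS q μ = sumℚ (map (prodTerms q (length μ) 0 0) (C μ))

mult : ℕ → List ℕ → ℕ
mult i μ = length (filter (ℕ._≟ i) μ)

-- ∏_i m_i(μ)! , i ranging over 0..|μ| (covers all parts; m_0 = 0 for a partition)
prodMultFact : List ℕ → ℕ
prodMultFact μ = List.foldr ℕ._*_ 1 (map (λ i → mult i μ !) (upTo (suc (sum μ))))

RHS : List ℕ → ℚ
RHS μ = ((+ (length μ !)) / 1) /' ((+ prodMultFact μ) / 1)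

-- Let σ range over all l! orderings of the parts of μ, repetitions included (perms μ). Each c ∈ C_μ
-- occurs ∏ᵢ mᵢ(μ)! times among them, so it suffices to show that the summand summed over all σ is l!.
-- Let term k be the summand with l - i + 1 replaced by k + l - i + 1, and chainSum k c the sum of
-- q ^ (j₁ c₁ + ⋯ + j_l c_l) over k ≥ j₁ ≥ ⋯ ≥ j_l ≥ 0. We show ∑_σ term k σ = ∑_σ chainSum k σ by
-- induction on l: the last partial sum [c_l] = |μ| is the same for every σ, so splitting off the last
-- entry y of σ reduces the claim to the recurrence
--   (1 - q^|μ|) ∑_σ chainSum k σ = ∑_y (1 - q^((k+1) y)) ∑_τ chainSum (k+1) τ   (τ ordering μ ∖ y),
-- which follows by expanding ∑_σ chainSum (k+1) σ once along the first entry of σ and once along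
-- the last. For k = 0 every chainSum is 1, so the sum is l!.
{-# OPTIONS --safe #-}
module Submission where

open import Defs
open import Data.Bool using (true; false; if_then_else_)
import Data.Integer as ℤ
import Data.Integer.Properties as ℤₚ
open import Data.List using (List; []; _∷_; _++_; [_]; map; concatMap; length; upTo)
open import Data.List.Membership.Propositional using (_∈_)
open import Data.List.Membership.Propositional.Properties using (∈-upTo⁺; ∈-deduplicate⁺)
open import Data.List.Properties using (≡-dec; length-map; length-++; filter-accept; filter-reject)
open import Data.List.Relation.Binary.Permutation.Propositional using (_↭_; ↭-refl; ↭-sym; ↭-trans; ↭-prep; ↭-swap)
open import Data.List.Relation.Binary.Permutation.Propositional.Properties using (↭-length; ↭-empty-inv; drop-∷; All-resp-↭; filter-↭)
open import Data.List.Relation.Unary.All as All using (All; []; _∷_)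
import Data.List.Relation.Unary.All.Properties as All
open import Data.List.Relation.Unary.AllPairs using ([]; _∷_)
open import Data.List.Relation.Unary.Any using (here; there)
open import Data.List.Relation.Unary.Unique.DecPropositional.Properties using (deduplicate-!)
open import Data.List.Relation.Unary.Unique.Propositional using (Unique)
open import Data.List.Relation.Unary.Unique.Propositional.Properties using (upTo⁺)
open import Data.Nat as ℕ using (ℕ; zero; suc; _≤_; _∸_; _!; s≤s; z≤n; NonZero)
import Data.Nat.Coprimality as Coprimality
open import Data.Nat.ListAction using (sum; product)
open import Data.Nat.ListAction.Properties using (sum-↭; product≢0)
import Data.Nat.Properties as ℕₚ
open import Algebra.Properties.CommutativeSemigroup ℕₚ.*-commutativeSemigroup using (x∙yz≈y∙xz)
open import Data.Product using (_×_; _,_; proj₁; proj₂; uncurry; map₂)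
open import Data.Rational as ℚ using (ℚ; 0ℚ; 1ℚ; _+_; _*_; _-_; mkℚ; 1/_)
import Data.Rational.Properties as ℚₚ
open import Data.Rational.Solver using (module +-*-Solver)
open import Function using (_∘_)
open import Relation.Binary.Definitions using (DecidableEquality)
open import Relation.Binary.PropositionalEquality using (_≡_; _≢_; refl; sym; trans; cong; cong₂; module ≡-Reasoning)
open import Relation.Nullary using (Dec; yes; no; does; proof; ofʸ; ofⁿ)
open import Relation.Nullary.Negation using (contradiction)
open ≡-Reasoning
open +-*-Solver

private
  variable
    A B : Set

toℚ : ℕ → ℚ
toℚ n = ℤ.+ n ℚ./ 1

toℚ≡mkℚ : ∀ n → toℚ n ≡ mkℚ (ℤ.+ n) 0 (Coprimality.sym (Coprimality.1-coprimeTo n))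
toℚ≡mkℚ n = ℚₚ.normalize-coprime (Coprimality.sym (Coprimality.1-coprimeTo n))

toℚ-+ : ∀ m n → toℚ (m ℕ.+ n) ≡ toℚ m + toℚ n
toℚ-+ m n = sym (begin
  toℚ m + toℚ n                                  ≡⟨ cong₂ _+_ (toℚ≡mkℚ m) (toℚ≡mkℚ n) ⟩
  (ℤ.+ m ℤ.* ℤ.+ 1 ℤ.+ ℤ.+ n ℤ.* ℤ.+ 1) ℚ./ 1   ≡⟨ cong (ℚ._/ 1) (cong₂ ℤ._+_ (ℤₚ.*-identityʳ (ℤ.+ m)) (ℤₚ.*-identityʳ (ℤ.+ n))) ⟩
  (ℤ.+ m ℤ.+ ℤ.+ n) ℚ./ 1                       ≡⟨ cong (ℚ._/ 1) (sym (ℤₚ.pos-+ m n)) ⟩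
  toℚ (m ℕ.+ n)                                  ∎)

toℚ-* : ∀ m n → toℚ (m ℕ.* n) ≡ toℚ m * toℚ n
toℚ-* m n = sym (begin
  toℚ m * toℚ n            ≡⟨ cong₂ _*_ (toℚ≡mkℚ m) (toℚ≡mkℚ n) ⟩
  (ℤ.+ m ℤ.* ℤ.+ n) ℚ./ 1  ≡⟨ cong (ℚ._/ 1) (sym (ℤₚ.pos-* m n)) ⟩
  toℚ (m ℕ.* n)            ∎)

toℚ-≢0 : ∀ n .{{_ : NonZero n}} → toℚ n ≢ 0ℚ
toℚ-≢0 (suc n) eq with trans (sym (cong ℚ.numerator (toℚ≡mkℚ (suc n)))) (cong ℚ.numerator eq)
... | ()

/'-as-* : ∀ p r → p /' r ≡ p * (1ℚ /' r)
/'-as-* p r with r ℚₚ.≟ 0ℚ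
... | yes _ = sym (ℚₚ.*-zeroʳ p)
... | no _  = cong (p *_) (sym (ℚₚ.*-identityˡ _))

*-/'-cancelˡ : ∀ {r} p → r ≢ 0ℚ → (r * p) /' r ≡ p
*-/'-cancelˡ {r} p r≢0 with r ℚₚ.≟ 0ℚ
... | yes r≡0 = contradiction r≡0 r≢0
... | no r≢0′ = begin
  (r * p) * 1/ r  ≡⟨ solve 3 (λ r p s → (r :* p) :* s := p :* (s :* r)) refl r p (1/ r) ⟩
  p * (1/ r * r)  ≡⟨ cong (p *_) (ℚₚ.*-inverseˡ r) ⟩
  p * 1ℚ          ≡⟨ ℚₚ.*-identityʳ p ⟩
  p               ∎
  where instance _ = ℚ.≢-nonZero r≢0′

/'-*-comm : ∀ p r s → (p /' r) * s ≡ (p * s) /' r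
/'-*-comm p r s = begin
  (p /' r) * s       ≡⟨ cong (_* s) (/'-as-* p r) ⟩
  p * (1ℚ /' r) * s  ≡⟨ solve 3 (λ p i s → p :* i :* s := p :* s :* i) refl p (1ℚ /' r) s ⟩
  p * s * (1ℚ /' r)  ≡⟨ sym (/'-as-* (p * s) r) ⟩
  (p * s) /' r       ∎

∑ : (A → ℚ) → List A → ℚ
∑ f xs = sumℚ (map f xs)

∑-cong : {f g : A → ℚ} → (∀ x → f x ≡ g x) → ∀ xs → ∑ f xs ≡ ∑ g xs
∑-cong f≗g []       = refl
∑-cong f≗g (x ∷ xs) = cong₂ _+_ (f≗g x) (∑-cong f≗g xs)

∑-cong-local : {f g : A → ℚ} {xs : List A} → All (λ x → f x ≡ g x) xs → ∑ f xs ≡ ∑ g xs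
∑-cong-local []             = refl
∑-cong-local (fx≡gx ∷ f≗g) = cong₂ _+_ fx≡gx (∑-cong-local f≗g)

∑-map : (f : B → ℚ) (g : A → B) (xs : List A) → ∑ f (map g xs) ≡ ∑ (f ∘ g) xs
∑-map f g []       = refl
∑-map f g (x ∷ xs) = cong (f (g x) +_) (∑-map f g xs)

∑-++ : (f : A → ℚ) (xs ys : List A) → ∑ f (xs ++ ys) ≡ ∑ f xs + ∑ f ys
∑-++ f []       ys = sym (ℚₚ.+-identityˡ _)
∑-++ f (x ∷ xs) ys = trans (cong (f x +_) (∑-++ f xs ys)) (sym (ℚₚ.+-assoc (f x) _ _))

∑-concatMap : (f : B → ℚ) (g : A → List B) (xs : List A) → ∑ f (concatMap g xs) ≡ ∑ (∑ f ∘ g) xs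
∑-concatMap f g []       = refl
∑-concatMap f g (x ∷ xs) = trans (∑-++ f (g x) (concatMap g xs)) (cong (∑ f (g x) +_) (∑-concatMap f g xs))

∑-0 : (xs : List A) → ∑ (λ _ → 0ℚ) xs ≡ 0ℚ
∑-0 []       = refl
∑-0 (x ∷ xs) = trans (ℚₚ.+-identityˡ _) (∑-0 xs)

∑-+ : (f g : A → ℚ) (xs : List A) → ∑ (λ x → f x + g x) xs ≡ ∑ f xs + ∑ g xs
∑-+ f g []       = sym (ℚₚ.+-identityˡ 0ℚ)
∑-+ f g (x ∷ xs) = begin
  (f x + g x) + ∑ (λ x → f x + g x) xs  ≡⟨ cong ((f x + g x) +_) (∑-+ f g xs) ⟩
  (f x + g x) + (∑ f xs + ∑ g xs)       ≡⟨ solve 4 (λ a b s t → (a :+ b) :+ (s :+ t) := (a :+ s) :+ (b :+ t)) refl (f x) (g x) (∑ f xs) (∑ g xs) ⟩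
  (f x + ∑ f xs) + (g x + ∑ g xs)       ∎

∑-- : (f g : A → ℚ) (xs : List A) → ∑ (λ x → f x - g x) xs ≡ ∑ f xs - ∑ g xs
∑-- f g []       = refl
∑-- f g (x ∷ xs) = begin
  (f x - g x) + ∑ (λ x → f x - g x) xs  ≡⟨ cong ((f x - g x) +_) (∑-- f g xs) ⟩
  (f x - g x) + (∑ f xs - ∑ g xs)       ≡⟨ solve 4 (λ a b s t → (a :- b) :+ (s :- t) := (a :+ s) :- (b :+ t)) refl (f x) (g x) (∑ f xs) (∑ g xs) ⟩
  (f x + ∑ f xs) - (g x + ∑ g xs)       ∎

∑-*ˡ : (c : ℚ) (f : A → ℚ) (xs : List A) → ∑ (λ x → c * f x) xs ≡ c * ∑ f xs
∑-*ˡ c f []       = sym (ℚₚ.*-zeroʳ c)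
∑-*ˡ c f (x ∷ xs) = trans (cong (c * f x +_) (∑-*ˡ c f xs)) (sym (ℚₚ.*-distribˡ-+ c (f x) _))

∑-/' : (f : A → ℚ) (r : ℚ) (xs : List A) → ∑ (λ x → f x /' r) xs ≡ ∑ f xs /' r
∑-/' f r xs = begin
  ∑ (λ x → f x /' r) xs         ≡⟨ ∑-cong (λ x → trans (/'-as-* (f x) r) (ℚₚ.*-comm (f x) _)) xs ⟩
  ∑ (λ x → (1ℚ /' r) * f x) xs  ≡⟨ ∑-*ˡ (1ℚ /' r) f xs ⟩
  (1ℚ /' r) * ∑ f xs            ≡⟨ trans (ℚₚ.*-comm _ (∑ f xs)) (sym (/'-as-* (∑ f xs) r)) ⟩
  ∑ f xs /' r                   ∎

∑-const : (c : ℚ) (xs : List A) → ∑ (λ _ → c) xs ≡ toℚ (length xs) * c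
∑-const c []       = sym (ℚₚ.*-zeroˡ c)
∑-const c (x ∷ xs) = begin
  c + ∑ (λ _ → c) xs          ≡⟨ cong (c +_) (∑-const c xs) ⟩
  c + toℚ (length xs) * c     ≡⟨ solve 2 (λ c n → c :+ n :* c := (con 1ℚ :+ n) :* c) refl c (toℚ (length xs)) ⟩
  (1ℚ + toℚ (length xs)) * c  ≡⟨ cong (_* c) (sym (toℚ-+ 1 (length xs))) ⟩
  toℚ (suc (length xs)) * c   ∎

∑-comm : (f : A → B → ℚ) (xs : List A) (ys : List B) → ∑ (λ y → ∑ (λ x → f x y) xs) ys ≡ ∑ (λ x → ∑ (f x) ys) xs
∑-comm f xs []       = sym (∑-0 xs)
∑-comm f xs (y ∷ ys) = begin
  ∑ (λ x → f x y) xs + ∑ (λ y → ∑ (λ x → f x y) xs) ys  ≡⟨ cong (∑ (λ x → f x y) xs +_) (∑-comm f xs ys) ⟩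
  ∑ (λ x → f x y) xs + ∑ (λ x → ∑ (f x) ys) xs          ≡⟨ sym (∑-+ (λ x → f x y) (λ x → ∑ (f x) ys) xs) ⟩
  ∑ (λ x → f x y + ∑ (f x) ys) xs                        ∎

-- Orderings of a multiset

↭-swap-prep : ∀ {x z : A} {r d} → x ∷ r ↭ d → x ∷ z ∷ r ↭ z ∷ d
↭-swap-prep {x = x} {z} x∷r↭d = ↭-trans (↭-swap x z ↭-refl) (↭-prep z x∷r↭d)

picks : List A → List (A × List A)
picks []       = []
picks (x ∷ xs) = (x , xs) ∷ map (map₂ (x ∷_)) (picks xs)

picks-↭ : (xs : List A) → All (λ p → proj₁ p ∷ proj₂ p ↭ xs) (picks xs)
picks-↭ []       = []
picks-↭ (x ∷ xs) = ↭-refl ∷ All.map⁺ (All.map ↭-swap-prep (picks-↭ xs))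

length-picks : (xs : List A) → length (picks xs) ≡ length xs
length-picks []       = refl
length-picks (x ∷ xs) = cong suc (trans (length-map _ (picks xs)) (length-picks xs))

insertEverywhere-↭ : ∀ x d → All (_↭ x ∷ d) (insertEverywhere x d)
insertEverywhere-↭ x []      = ↭-refl ∷ []
insertEverywhere-↭ x (y ∷ d) =
  ↭-refl ∷ All.map⁺ (All.map (λ e↭xd → ↭-trans (↭-prep y e↭xd) (↭-swap y x ↭-refl)) (insertEverywhere-↭ x d))

perms-↭ : ∀ S → All (_↭ S) (perms S)
perms-↭ []       = ↭-refl ∷ []
perms-↭ (x ∷ xs) = All.concat⁺ (All.map⁺ (All.map insertions-↭ (perms-↭ xs)))
  where
  insertions-↭ : ∀ {d} → d ↭ xs → All (_↭ x ∷ xs) (insertEverywhere x d)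
  insertions-↭ {d} d↭xs = All.map (λ e↭xd → ↭-trans e↭xd (↭-prep x d↭xs)) (insertEverywhere-↭ x d)

sum-∷ʳ-↭ : ∀ {y r τ S} → τ ↭ r → y ∷ r ↭ S → sum τ ℕ.+ y ≡ sum S
sum-∷ʳ-↭ {y} {r} {τ} {S} τ↭r yr↭S = begin
  sum τ ℕ.+ y  ≡⟨ cong (ℕ._+ y) (sum-↭ τ↭r) ⟩
  sum r ℕ.+ y  ≡⟨ ℕₚ.+-comm (sum r) y ⟩
  sum (y ∷ r)  ≡⟨ sum-↭ yr↭S ⟩
  sum S        ∎

∑-perms-∷ : (f : List ℕ → ℚ) (x : ℕ) (xs : List ℕ) → ∑ f (perms (x ∷ xs)) ≡ ∑ (∑ f ∘ insertEverywhere x) (perms xs)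
∑-perms-∷ f x xs = ∑-concatMap f (insertEverywhere x) (perms xs)

∑-picks : (ℕ → List ℕ → ℚ) → List ℕ → ℚ
∑-picks f S = ∑ (uncurry λ y r → ∑ (f y) (perms r)) (picks S)

∑-picks-∷ : (f : ℕ → List ℕ → ℚ) (x : ℕ) (xs : List ℕ) →
            ∑-picks f (x ∷ xs) ≡ ∑ (f x) (perms xs) + ∑ (uncurry λ y r → ∑ (f y) (perms (x ∷ r))) (picks xs)
∑-picks-∷ f x xs = cong (∑ (f x) (perms xs) +_) (∑-map _ (map₂ (x ∷_)) (picks xs))

∑-picks-cong : (S : List ℕ) {f g : ℕ → List ℕ → ℚ} →
               (∀ {y r τ} → y ∷ r ↭ S → τ ↭ r → f y τ ≡ g y τ) → ∑-picks f S ≡ ∑-picks g S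
∑-picks-cong S f≈g = ∑-cong-local (All.map (λ {p} yr↭S → ∑-cong-local (All.map (f≈g yr↭S) (perms-↭ (proj₂ p)))) (picks-↭ S))

∑-picks-+ : (f g : ℕ → List ℕ → ℚ) (S : List ℕ) → ∑-picks (λ y τ → f y τ + g y τ) S ≡ ∑-picks f S + ∑-picks g S
∑-picks-+ f g S = trans (∑-cong (λ p → ∑-+ (f (proj₁ p)) (g (proj₁ p)) (perms (proj₂ p))) (picks S)) (∑-+ _ _ (picks S))

∑-picks-*ˡ : (c : ℕ → ℚ) (f : ℕ → List ℕ → ℚ) (S : List ℕ) →
             ∑-picks (λ y τ → c y * f y τ) S ≡ ∑ (uncurry λ y r → c y * ∑ (f y) (perms r)) (picks S)
∑-picks-*ˡ c f S = ∑-cong (λ p → ∑-*ˡ (c (proj₁ p)) (f (proj₁ p)) (perms (proj₂ p))) (picks S)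

∑-insertsAfterHead : (List ℕ → ℚ) → ℕ → List ℕ → ℚ
∑-insertsAfterHead f x []      = 0ℚ
∑-insertsAfterHead f x (y ∷ d) = ∑ (f ∘ (y ∷_)) (insertEverywhere x d)

∑-insertEverywhere-head : (f : List ℕ → ℚ) (x : ℕ) (d : List ℕ) →
                          ∑ f (insertEverywhere x d) ≡ f (x ∷ d) + ∑-insertsAfterHead f x d
∑-insertEverywhere-head f x []      = refl
∑-insertEverywhere-head f x (y ∷ d) = cong (f (x ∷ y ∷ d) +_) (∑-map f (y ∷_) (insertEverywhere x d))

∑-perms-head : (f : List ℕ → ℚ) (x : ℕ) (xs : List ℕ) → ∑ f (perms (x ∷ xs)) ≡ ∑-picks (λ y τ → f (y ∷ τ)) (x ∷ xs)
∑-perms-head f x []        = sym (ℚₚ.+-identityʳ _)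
∑-perms-head f x (x′ ∷ xs) = begin
  ∑ f (perms (x ∷ x′ ∷ xs))
    ≡⟨ ∑-perms-∷ f x (x′ ∷ xs) ⟩
  ∑ (∑ f ∘ insertEverywhere x) (perms (x′ ∷ xs))
    ≡⟨ ∑-cong (∑-insertEverywhere-head f x) (perms (x′ ∷ xs)) ⟩
  ∑ (λ d → f (x ∷ d) + g d) (perms (x′ ∷ xs))
    ≡⟨ ∑-+ (f ∘ (x ∷_)) g (perms (x′ ∷ xs)) ⟩
  atHead + ∑ g (perms (x′ ∷ xs))
    ≡⟨ cong (atHead +_) (∑-perms-head g x′ xs) ⟩
  atHead + ∑-picks (λ y τ → g (y ∷ τ)) (x′ ∷ xs)
    ≡⟨ cong (atHead +_) (∑-cong (λ p → sym (∑-perms-∷ (f ∘ (proj₁ p ∷_)) x (proj₂ p))) (picks (x′ ∷ xs))) ⟩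
  atHead + ∑ (uncurry λ y r → ∑ (λ τ → f (y ∷ τ)) (perms (x ∷ r))) (picks (x′ ∷ xs))
    ≡⟨ sym (∑-picks-∷ (λ y τ → f (y ∷ τ)) x (x′ ∷ xs)) ⟩
  ∑-picks (λ y τ → f (y ∷ τ)) (x ∷ x′ ∷ xs) ∎
  where
  g = ∑-insertsAfterHead f x
  atHead = ∑ (f ∘ (x ∷_)) (perms (x′ ∷ xs))

∑-insertsBeforeLast : (List ℕ → ℚ) → ℕ → List ℕ → ℚ
∑-insertsBeforeLast f x []      = 0ℚ
∑-insertsBeforeLast f x (y ∷ d) = f (x ∷ y ∷ d) + ∑-insertsBeforeLast (f ∘ (y ∷_)) x d

∑-insertEverywhere-last : (f : List ℕ → ℚ) (x : ℕ) (d : List ℕ) →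
                          ∑ f (insertEverywhere x d) ≡ f (d ++ [ x ]) + ∑-insertsBeforeLast f x d
∑-insertEverywhere-last f x []      = refl
∑-insertEverywhere-last f x (y ∷ d) = begin
  f (x ∷ y ∷ d) + ∑ f (map (y ∷_) (insertEverywhere x d))
    ≡⟨ cong (f (x ∷ y ∷ d) +_) (∑-map f (y ∷_) (insertEverywhere x d)) ⟩
  f (x ∷ y ∷ d) + ∑ (f ∘ (y ∷_)) (insertEverywhere x d)
    ≡⟨ cong (f (x ∷ y ∷ d) +_) (∑-insertEverywhere-last (f ∘ (y ∷_)) x d) ⟩
  f (x ∷ y ∷ d) + (f (y ∷ d ++ [ x ]) + rest)
    ≡⟨ solve 3 (λ a b c → a :+ (b :+ c) := b :+ (a :+ c)) refl (f (x ∷ y ∷ d)) (f (y ∷ d ++ [ x ])) rest ⟩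
  f (y ∷ d ++ [ x ]) + (f (x ∷ y ∷ d) + rest) ∎
  where rest = ∑-insertsBeforeLast (f ∘ (y ∷_)) x d

∑-insertsBeforeLast-∷ʳ : (f : List ℕ → ℚ) (x y : ℕ) (τ : List ℕ) →
                         ∑-insertsBeforeLast f x (τ ++ [ y ]) ≡ ∑ (λ e → f (e ++ [ y ])) (insertEverywhere x τ)
∑-insertsBeforeLast-∷ʳ f x y []      = refl
∑-insertsBeforeLast-∷ʳ f x y (z ∷ τ) = cong (f (x ∷ z ∷ τ ++ [ y ]) +_) (begin
  ∑-insertsBeforeLast (f ∘ (z ∷_)) x (τ ++ [ y ])              ≡⟨ ∑-insertsBeforeLast-∷ʳ (f ∘ (z ∷_)) x y τ ⟩
  ∑ (λ e → f (z ∷ e ++ [ y ])) (insertEverywhere x τ)           ≡⟨ sym (∑-map (λ e → f (e ++ [ y ])) (z ∷_) (insertEverywhere x τ)) ⟩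
  ∑ (λ e → f (e ++ [ y ])) (map (z ∷_) (insertEverywhere x τ))  ∎)

∑-perms-last : (f : List ℕ → ℚ) (x : ℕ) (xs : List ℕ) → ∑ f (perms (x ∷ xs)) ≡ ∑-picks (λ y τ → f (τ ++ [ y ])) (x ∷ xs)
∑-perms-last f x []        = sym (ℚₚ.+-identityʳ _)
∑-perms-last f x (x′ ∷ xs) = begin
  ∑ f (perms (x ∷ x′ ∷ xs))
    ≡⟨ ∑-perms-∷ f x (x′ ∷ xs) ⟩
  ∑ (∑ f ∘ insertEverywhere x) (perms (x′ ∷ xs))
    ≡⟨ ∑-cong (∑-insertEverywhere-last f x) (perms (x′ ∷ xs)) ⟩
  ∑ (λ d → f (d ++ [ x ]) + g d) (perms (x′ ∷ xs))
    ≡⟨ ∑-+ (λ d → f (d ++ [ x ])) g (perms (x′ ∷ xs)) ⟩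
  atLast + ∑ g (perms (x′ ∷ xs))
    ≡⟨ cong (atLast +_) (∑-perms-last g x′ xs) ⟩
  atLast + ∑-picks (λ y τ → g (τ ++ [ y ])) (x′ ∷ xs)
    ≡⟨ cong (atLast +_) (∑-cong (λ p → trans (∑-cong (∑-insertsBeforeLast-∷ʳ f x (proj₁ p)) (perms (proj₂ p)))
                                              (sym (∑-perms-∷ (λ e → f (e ++ [ proj₁ p ])) x (proj₂ p))))
                                 (picks (x′ ∷ xs))) ⟩
  atLast + ∑ (uncurry λ y r → ∑ (λ τ → f (τ ++ [ y ])) (perms (x ∷ r))) (picks (x′ ∷ xs))
    ≡⟨ sym (∑-picks-∷ (λ y τ → f (τ ++ [ y ])) x (x′ ∷ xs)) ⟩
  ∑-picks (λ y τ → f (τ ++ [ y ])) (x ∷ x′ ∷ xs) ∎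
  where
  g = ∑-insertsBeforeLast f x
  atLast = ∑ (λ d → f (d ++ [ x ])) (perms (x′ ∷ xs))

∑-1-perms : ∀ S → ∑ (λ _ → 1ℚ) (perms S) ≡ toℚ (length S !)
∑-1-perms S = go (length S) S refl
  where
  go : ∀ n S → length S ≡ n → ∑ (λ _ → 1ℚ) (perms S) ≡ toℚ (n !)
  go n       []       refl = refl
  go (suc n) (x ∷ xs) len  = begin
    ∑ (λ _ → 1ℚ) (perms (x ∷ xs))
      ≡⟨ ∑-perms-head (λ _ → 1ℚ) x xs ⟩
    ∑ (λ p → ∑ (λ _ → 1ℚ) (perms (proj₂ p))) (picks (x ∷ xs))
      ≡⟨ ∑-cong-local (All.map (λ {p} yr↭S → go n (proj₂ p) (ℕₚ.suc-injective (trans (↭-length yr↭S) len))) (picks-↭ (x ∷ xs))) ⟩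
    ∑ (λ _ → toℚ (n !)) (picks (x ∷ xs))
      ≡⟨ ∑-const (toℚ (n !)) (picks (x ∷ xs)) ⟩
    toℚ (length (picks (x ∷ xs))) * toℚ (n !)
      ≡⟨ cong (λ m → toℚ m * toℚ (n !)) (trans (length-picks (x ∷ xs)) len) ⟩
    toℚ (suc n) * toℚ (n !)
      ≡⟨ sym (toℚ-* (suc n) (n !)) ⟩
    toℚ (suc n !) ∎

-- Counting repeated orderings

_≟ₗ_ : DecidableEquality (List ℕ)
_≟ₗ_ = ≡-dec ℕ._≟_

𝟙 : {P : Set} → Dec P → ℚ
𝟙 P? = if does P? then 1ℚ else 0ℚ

δ : List ℕ → List ℕ → ℚ
δ a b = 𝟙 (a ≟ₗ b)

count : List ℕ → List (List ℕ) → ℚ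
count d = ∑ (δ d)

δ-refl : ∀ a → δ a a ≡ 1ℚ
δ-refl a with a ≟ₗ a
... | yes _   = refl
... | no a≢a = contradiction refl a≢a

δ-≢ : ∀ {a b} → a ≢ b → δ a b ≡ 0ℚ
δ-≢ {a} {b} a≢b with a ≟ₗ b
... | yes a≡b = contradiction a≡b a≢b
... | no _    = refl

δ-∷ : ∀ a as b bs → δ (a ∷ as) (b ∷ bs) ≡ 𝟙 (a ℕ.≟ b) * δ as bs
δ-∷ a as b bs with a ℕ.≡ᵇ b
... | true  = sym (ℚₚ.*-identityˡ (δ as bs))
... | false = sym (ℚₚ.*-zeroˡ (δ as bs))

∑-δ : ∀ {D y} (g : List ℕ → ℚ) → Unique D → y ∈ D → ∑ (λ d → δ d y * g d) D ≡ g y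
∑-δ {d ∷ D} {y} g (y∉D ∷ _) (here refl) = begin
  δ y y * g y + ∑ (λ d → δ d y * g d) D
    ≡⟨ cong₂ _+_ (cong (_* g y) (δ-refl y)) (∑-cong-local (All.map (λ y≢d → cong (_* g _) (δ-≢ (y≢d ∘ sym))) y∉D)) ⟩
  1ℚ * g y + ∑ (λ d → 0ℚ * g d) D
    ≡⟨ cong₂ _+_ (ℚₚ.*-identityˡ (g y)) (trans (∑-cong (λ d → ℚₚ.*-zeroˡ (g d)) D) (∑-0 D)) ⟩
  g y + 0ℚ
    ≡⟨ ℚₚ.+-identityʳ (g y) ⟩
  g y ∎
∑-δ {d ∷ D} {y} g (d∉D ∷ D!) (there y∈D) = begin
  δ d y * g d + ∑ (λ d → δ d y * g d) D  ≡⟨ cong₂ _+_ (cong (_* g d) (δ-≢ (All.lookup d∉D y∈D))) (∑-δ g D! y∈D) ⟩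
  0ℚ * g d + g y                         ≡⟨ cong (_+ g y) (ℚₚ.*-zeroˡ (g d)) ⟩
  0ℚ + g y                               ≡⟨ ℚₚ.+-identityˡ (g y) ⟩
  g y                                    ∎

∑-by-count : ∀ {D L} (f : List ℕ → ℚ) → Unique D → All (_∈ D) L → ∑ f L ≡ ∑ (λ d → count d L * f d) D
∑-by-count {D} {[]}    f D! []          = sym (trans (∑-cong (λ d → ℚₚ.*-zeroˡ (f d)) D) (∑-0 D))
∑-by-count {D} {y ∷ L} f D! (y∈D ∷ L⊆D) = begin
  f y + ∑ f L                                            ≡⟨ cong₂ _+_ (sym (∑-δ f D! y∈D)) (∑-by-count f D! L⊆D) ⟩
  ∑ (λ d → δ d y * f d) D + ∑ (λ d → count d L * f d) D  ≡⟨ sym (∑-+ _ _ D) ⟩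
  ∑ (λ d → δ d y * f d + count d L * f d) D              ≡⟨ ∑-cong (λ d → sym (ℚₚ.*-distribʳ-+ (f d) (δ d y) (count d L))) D ⟩
  ∑ (λ d → count d (y ∷ L) * f d) D                      ∎

mult-↭ : ∀ x {μ ν} → μ ↭ ν → mult x μ ≡ mult x ν
mult-↭ x μ↭ν = ↭-length (filter-↭ (ℕ._≟ x) μ↭ν)

mult-∷-≡ : ∀ x xs → mult x (x ∷ xs) ≡ suc (mult x xs)
mult-∷-≡ x xs = cong length (filter-accept (ℕ._≟ x) refl)

mult-∷-≢ : ∀ {x i} xs → x ≢ i → mult i (x ∷ xs) ≡ mult i xs
mult-∷-≢ xs x≢i = cong length (filter-reject (ℕ._≟ _) x≢i)

removals : ℕ → List ℕ → List (List ℕ)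
removals x []      = []
removals x (z ∷ d) = if does (z ℕ.≟ x) then d ∷ map (z ∷_) (removals x d) else map (z ∷_) (removals x d)

removals-↭ : ∀ x d → All (λ r → x ∷ r ↭ d) (removals x d)
removals-↭ x []      = []
removals-↭ x (z ∷ d) with z ℕ.≡ᵇ x | proof (z ℕ.≟ x)
... | true  | ofʸ refl = ↭-refl ∷ All.map⁺ (All.map ↭-swap-prep (removals-↭ x d))
... | false | ofⁿ _    = All.map⁺ (All.map ↭-swap-prep (removals-↭ x d))

length-removals : ∀ x d → length (removals x d) ≡ mult x d
length-removals x []      = refl
length-removals x (z ∷ d) with z ℕ.≡ᵇ x
... | true  = cong suc (trans (length-map _ (removals x d)) (length-removals x d))
... | false = trans (length-map _ (removals x d)) (length-removals x d)

∑-removals-∷ : (g : List ℕ → ℚ) (x z : ℕ) (d : List ℕ) →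
               ∑ g (removals x (z ∷ d)) ≡ 𝟙 (z ℕ.≟ x) * g d + ∑ (g ∘ (z ∷_)) (removals x d)
∑-removals-∷ g x z d with z ℕ.≡ᵇ x
... | true  = cong₂ _+_ (sym (ℚₚ.*-identityˡ (g d))) (∑-map g (z ∷_) (removals x d))
... | false = begin
  ∑ g (map (z ∷_) (removals x d))          ≡⟨ ∑-map g (z ∷_) (removals x d) ⟩
  ∑ (g ∘ (z ∷_)) (removals x d)            ≡⟨ sym (ℚₚ.+-identityˡ _) ⟩
  0ℚ + ∑ (g ∘ (z ∷_)) (removals x d)       ≡⟨ cong (_+ ∑ (g ∘ (z ∷_)) (removals x d)) (sym (ℚₚ.*-zeroˡ (g d))) ⟩
  0ℚ * g d + ∑ (g ∘ (z ∷_)) (removals x d) ∎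

count-map-∷ : ∀ z d y L → count (z ∷ d) (map (y ∷_) L) ≡ 𝟙 (z ℕ.≟ y) * count d L
count-map-∷ z d y L = begin
  count (z ∷ d) (map (y ∷_) L)     ≡⟨ ∑-map (δ (z ∷ d)) (y ∷_) L ⟩
  ∑ (λ e → δ (z ∷ d) (y ∷ e)) L    ≡⟨ ∑-cong (δ-∷ z d y) L ⟩
  ∑ (λ e → 𝟙 (z ℕ.≟ y) * δ d e) L  ≡⟨ ∑-*ˡ (𝟙 (z ℕ.≟ y)) (δ d) L ⟩
  𝟙 (z ℕ.≟ y) * count d L          ∎

count-insertEverywhere : ∀ x e d → count d (insertEverywhere x e) ≡ ∑ (λ r → δ r e) (removals x d)
count-insertEverywhere x []      []      = refl
count-insertEverywhere x []      (z ∷ d) = begin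
  δ (z ∷ d) [ x ] + 0ℚ
    ≡⟨ cong₂ _+_ (δ-∷ z d x []) (sym (∑-0 (removals x d))) ⟩
  𝟙 (z ℕ.≟ x) * δ d [] + ∑ (λ r → δ (z ∷ r) []) (removals x d)
    ≡⟨ sym (∑-removals-∷ (λ r → δ r []) x z d) ⟩
  ∑ (λ r → δ r []) (removals x (z ∷ d)) ∎
count-insertEverywhere x (y ∷ e) []      =
  trans (ℚₚ.+-identityˡ _) (trans (∑-map (δ []) (y ∷_) (insertEverywhere x e)) (∑-0 (insertEverywhere x e)))
count-insertEverywhere x (y ∷ e) (z ∷ d) = begin
  δ (z ∷ d) (x ∷ y ∷ e) + count (z ∷ d) (map (y ∷_) (insertEverywhere x e))
    ≡⟨ cong₂ _+_ (δ-∷ z d x (y ∷ e)) (count-map-∷ z d y (insertEverywhere x e)) ⟩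
  atHead + 𝟙 (z ℕ.≟ y) * count d (insertEverywhere x e)
    ≡⟨ cong (λ c → atHead + 𝟙 (z ℕ.≟ y) * c) (count-insertEverywhere x e d) ⟩
  atHead + 𝟙 (z ℕ.≟ y) * ∑ (λ r → δ r e) (removals x d)
    ≡⟨ cong (atHead +_) (sym (trans (∑-cong (λ r → δ-∷ z r y e) (removals x d))
                                    (∑-*ˡ (𝟙 (z ℕ.≟ y)) (λ r → δ r e) (removals x d)))) ⟩
  atHead + ∑ (λ r → δ (z ∷ r) (y ∷ e)) (removals x d)
    ≡⟨ sym (∑-removals-∷ (λ r → δ r (y ∷ e)) x z d) ⟩
  ∑ (λ r → δ r (y ∷ e)) (removals x (z ∷ d)) ∎
  where atHead = 𝟙 (z ℕ.≟ x) * δ d (y ∷ e)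

multFactorials : List ℕ → List ℕ → ℕ
multFactorials I μ = product (map (λ i → mult i μ !) I)

multFactorials-[] : ∀ I → multFactorials I [] ≡ 1
multFactorials-[] []      = refl
multFactorials-[] (i ∷ I) = trans (ℕₚ.*-identityˡ _) (multFactorials-[] I)

multFactorials-∷-∉ : ∀ {x} xs I → All (x ≢_) I → multFactorials I (x ∷ xs) ≡ multFactorials I xs
multFactorials-∷-∉ xs []      []          = refl
multFactorials-∷-∉ xs (i ∷ I) (x≢i ∷ x∉I) = cong₂ ℕ._*_ (cong _! (mult-∷-≢ xs x≢i)) (multFactorials-∷-∉ xs I x∉I)

multFactorials-∷ : ∀ {I x} xs → Unique I → x ∈ I → multFactorials I (x ∷ xs) ≡ suc (mult x xs) ℕ.* multFactorials I xs
multFactorials-∷ {x ∷ I} {x} xs (x∉I ∷ _) (here refl) = begin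
  mult x (x ∷ xs) ! ℕ.* multFactorials I (x ∷ xs)
    ≡⟨ cong₂ ℕ._*_ (cong _! (mult-∷-≡ x xs)) (multFactorials-∷-∉ xs I x∉I) ⟩
  (suc (mult x xs) ℕ.* mult x xs !) ℕ.* multFactorials I xs
    ≡⟨ ℕₚ.*-assoc (suc (mult x xs)) (mult x xs !) (multFactorials I xs) ⟩
  suc (mult x xs) ℕ.* (mult x xs ! ℕ.* multFactorials I xs) ∎
multFactorials-∷ {i ∷ I} {x} xs (i∉I ∷ I!) (there x∈I) = begin
  mult i (x ∷ xs) ! ℕ.* multFactorials I (x ∷ xs)
    ≡⟨ cong₂ ℕ._*_ (cong _! (mult-∷-≢ xs (All.lookup i∉I x∈I ∘ sym))) (multFactorials-∷ xs I! x∈I) ⟩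
  mult i xs ! ℕ.* (suc (mult x xs) ℕ.* multFactorials I xs)
    ≡⟨ x∙yz≈y∙xz (mult i xs !) (suc (mult x xs)) (multFactorials I xs) ⟩
  suc (mult x xs) ℕ.* (mult i xs ! ℕ.* multFactorials I xs) ∎

multFactorials-nonZero : ∀ I μ → NonZero (multFactorials I μ)
multFactorials-nonZero I μ = product≢0 (All.map⁺ (All.universal (λ i → mult i μ !≢0) I))
  where open ℕₚ using (_!≢0)

count-perms : ∀ {I} L {d} → Unique I → All (_∈ I) L → d ↭ L → count d (perms L) ≡ toℚ (multFactorials I L)
count-perms {I} [] I! _ d↭[] rewrite ↭-empty-inv d↭[] = cong toℚ (sym (multFactorials-[] I))
count-perms {I} (x ∷ xs) {d} I! (x∈I ∷ xs⊆I) d↭L = begin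
  count d (perms (x ∷ xs))
    ≡⟨ ∑-perms-∷ (δ d) x xs ⟩
  ∑ (count d ∘ insertEverywhere x) (perms xs)
    ≡⟨ ∑-cong (λ e → count-insertEverywhere x e d) (perms xs) ⟩
  ∑ (λ e → ∑ (λ r → δ r e) (removals x d)) (perms xs)
    ≡⟨ ∑-comm δ (removals x d) (perms xs) ⟩
  ∑ (λ r → count r (perms xs)) (removals x d)
    ≡⟨ ∑-cong-local (All.map (λ xr↭d → count-perms xs I! xs⊆I (drop-∷ (↭-trans xr↭d d↭L))) (removals-↭ x d)) ⟩
  ∑ (λ _ → toℚ (multFactorials I xs)) (removals x d)
    ≡⟨ ∑-const _ (removals x d) ⟩
  toℚ (length (removals x d)) * toℚ (multFactorials I xs)
    ≡⟨ cong (λ m → toℚ m * toℚ (multFactorials I xs)) (trans (length-removals x d) (trans (mult-↭ x d↭L) (mult-∷-≡ x xs))) ⟩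
  toℚ (suc (mult x xs)) * toℚ (multFactorials I xs)
    ≡⟨ sym (toℚ-* (suc (mult x xs)) (multFactorials I xs)) ⟩
  toℚ (suc (mult x xs) ℕ.* multFactorials I xs)
    ≡⟨ cong toℚ (sym (multFactorials-∷ xs I! x∈I)) ⟩
  toℚ (multFactorials I (x ∷ xs)) ∎

All-≤-sum : ∀ μ → All (_≤ sum μ) μ
All-≤-sum []       = []
All-≤-sum (x ∷ xs) = ℕₚ.m≤m+n x (sum xs) ∷ All.map (λ x≤ → ℕₚ.≤-trans x≤ (ℕₚ.m≤n+m (sum xs) x)) (All-≤-sum xs)

∑-perms≡prodMultFact*∑-C : (f : List ℕ → ℚ) (μ : List ℕ) → ∑ f (perms μ) ≡ toℚ (prodMultFact μ) * ∑ f (C μ)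
∑-perms≡prodMultFact*∑-C f μ = begin
  ∑ f (perms μ)
    ≡⟨ ∑-by-count f (deduplicate-! _≟ₗ_ (perms μ)) (All.tabulate (∈-deduplicate⁺ _≟ₗ_)) ⟩
  ∑ (λ c → count c (perms μ) * f c) (C μ)
    ≡⟨ ∑-cong-local (All.map (λ c↭μ → cong (_* f _) (count-perms μ I! μ⊆I c↭μ)) (All.deduplicate⁺ _≟ₗ_ (perms-↭ μ))) ⟩
  ∑ (λ c → toℚ (prodMultFact μ) * f c) (C μ)
    ≡⟨ ∑-*ˡ (toℚ (prodMultFact μ)) f (C μ) ⟩
  toℚ (prodMultFact μ) * ∑ f (C μ) ∎
  where
  I = upTo (suc (sum μ))
  I! : Unique I
  I! = upTo⁺ (suc (sum μ))
  μ⊆I : All (_∈ I) μ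
  μ⊆I = All.map (λ x≤ → ∈-upTo⁺ (s≤s x≤)) (All-≤-sum μ)

-- The q-series identity

module _ (q : ℚ) where

  ^-distribˡ-+-* : ∀ m n → q ^ (m ℕ.+ n) ≡ q ^ m * q ^ n
  ^-distribˡ-+-* zero    n = sym (ℚₚ.*-identityˡ _)
  ^-distribˡ-+-* (suc m) n = trans (cong (q *_) (^-distribˡ-+-* m n)) (sym (ℚₚ.*-assoc q _ _))

  ^-split-head : ∀ y t z → q ^ (y ℕ.+ t ℕ.+ z) ≡ q ^ y * q ^ (t ℕ.+ z)
  ^-split-head y t z = trans (cong (q ^_) (ℕₚ.+-assoc y t z)) (^-distribˡ-+-* y (t ℕ.+ z))

  -- chainSum k c = ∑ q ^ (j₁ c₁ + ⋯ + j_l c_l) over k ≥ j₁ ≥ ⋯ ≥ j_l ≥ 0, split according to whether j₁ attains the bound k.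
  chainSum : ℕ → List ℕ → ℚ
  chainSum zero    c       = 1ℚ
  chainSum (suc k) []      = 1ℚ
  chainSum (suc k) (y ∷ τ) = chainSum k (y ∷ τ) + q ^ (suc k ℕ.* y) * chainSum (suc k) τ

  -- Either j_l = 0, or all the j_i can be lowered by one, dividing the weight by q ^ (c₁ + ⋯ + c_l).
  chainSum-∷ʳ : ∀ k τ z → chainSum (suc k) (τ ++ [ z ]) ≡ chainSum (suc k) τ + q ^ (sum τ ℕ.+ z) * chainSum k (τ ++ [ z ])
  chainSum-∷ʳ zero    []      z = cong (λ n → 1ℚ + q ^ n * 1ℚ) (ℕₚ.*-identityˡ z)
  chainSum-∷ʳ (suc k) []      z = begin
    chainSum (suc k) [ z ] + q ^ (suc (suc k) ℕ.* z) * 1ℚ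
      ≡⟨ cong₂ (λ u v → u + v * 1ℚ) (chainSum-∷ʳ k [] z) (^-distribˡ-+-* z (suc k ℕ.* z)) ⟩
    (1ℚ + a * chainSum k [ z ]) + (a * b) * 1ℚ
      ≡⟨ solve 3 (λ a b c → (con 1ℚ :+ a :* c) :+ (a :* b) :* con 1ℚ := con 1ℚ :+ a :* (c :+ b :* con 1ℚ)) refl a b (chainSum k [ z ]) ⟩
    1ℚ + a * (chainSum k [ z ] + b * 1ℚ) ∎
    where a = q ^ z; b = q ^ (suc k ℕ.* z)
  chainSum-∷ʳ zero    (y ∷ τ) z = begin
    1ℚ + q ^ (1 ℕ.* y) * chainSum 1 (τ ++ [ z ])
      ≡⟨ cong₂ (λ u v → 1ℚ + u * v) q^1*y≡a (chainSum-∷ʳ 0 τ z) ⟩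
    1ℚ + a * (chainSum 1 τ + c * 1ℚ)
      ≡⟨ solve 3 (λ a c t → con 1ℚ :+ a :* (t :+ c :* con 1ℚ) := (con 1ℚ :+ a :* t) :+ (a :* c) :* con 1ℚ) refl a c (chainSum 1 τ) ⟩
    (1ℚ + a * chainSum 1 τ) + (a * c) * 1ℚ
      ≡⟨ cong₂ (λ u v → (1ℚ + u * chainSum 1 τ) + v * 1ℚ) (sym q^1*y≡a) (sym (^-split-head y (sum τ) z)) ⟩
    (1ℚ + q ^ (1 ℕ.* y) * chainSum 1 τ) + q ^ (y ℕ.+ sum τ ℕ.+ z) * 1ℚ ∎
    where
    a = q ^ y; c = q ^ (sum τ ℕ.+ z)
    q^1*y≡a : q ^ (1 ℕ.* y) ≡ a
    q^1*y≡a = cong (q ^_) (ℕₚ.*-identityˡ y)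
  chainSum-∷ʳ (suc k) (y ∷ τ) z = begin
    chainSum (suc k) (y ∷ τz) + q ^ (suc (suc k) ℕ.* y) * chainSum (suc (suc k)) τz
      ≡⟨ cong₂ (λ u v → u + q ^ (suc (suc k) ℕ.* y) * v) (chainSum-∷ʳ k (y ∷ τ) z) (chainSum-∷ʳ (suc k) τ z) ⟩
    (B₁ + q ^ (y ℕ.+ sum τ ℕ.+ z) * B₀) + q ^ (suc (suc k) ℕ.* y) * (A₂ + c * A₁)
      ≡⟨ cong₂ (λ u v → (B₁ + u * B₀) + v * (A₂ + c * A₁)) (^-split-head y (sum τ) z) q^[k+2]y≡ab ⟩
    (B₁ + (a * c) * B₀) + (a * b) * (A₂ + c * A₁)
      ≡⟨ solve 7 (λ a b c B₁ B₀ A₂ A₁ → (B₁ :+ (a :* c) :* B₀) :+ (a :* b) :* (A₂ :+ c :* A₁)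
                                      := (B₁ :+ (a :* b) :* A₂) :+ (a :* c) :* (B₀ :+ b :* A₁)) refl a b c B₁ B₀ A₂ A₁ ⟩
    (B₁ + (a * b) * A₂) + (a * c) * (B₀ + b * A₁)
      ≡⟨ sym (cong₂ (λ u v → (B₁ + u * A₂) + v * (B₀ + b * A₁)) q^[k+2]y≡ab (^-split-head y (sum τ) z)) ⟩
    (B₁ + q ^ (suc (suc k) ℕ.* y) * A₂) + q ^ (y ℕ.+ sum τ ℕ.+ z) * (B₀ + q ^ (suc k ℕ.* y) * A₁) ∎
    where
    τz = τ ++ [ z ]
    a = q ^ y; b = q ^ (suc k ℕ.* y); c = q ^ (sum τ ℕ.+ z)
    B₁ = chainSum (suc k) (y ∷ τ); B₀ = chainSum k (y ∷ τz)
    A₂ = chainSum (suc (suc k)) τ; A₁ = chainSum (suc k) τz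
    q^[k+2]y≡ab : q ^ (suc (suc k) ℕ.* y) ≡ a * b
    q^[k+2]y≡ab = ^-distribˡ-+-* y (suc k ℕ.* y)

  factor : ℕ → ℕ → ℕ → ℕ → ℚ
  factor l i acc x = (1ℚ - q ^ ((l ∸ i) ℕ.* x)) /' (1ℚ - q ^ (acc ℕ.+ x))

  prodTerms-∷ʳ : ∀ l acc i τ y → prodTerms q l acc i (τ ++ [ y ]) ≡ prodTerms q l acc i τ * factor l (i ℕ.+ length τ) (acc ℕ.+ sum τ) y
  prodTerms-∷ʳ l acc i []      y = begin
    factor l i acc y * 1ℚ                  ≡⟨ ℚₚ.*-identityʳ _ ⟩
    factor l i acc y                       ≡⟨ cong₂ (λ j s → factor l j s y) (sym (ℕₚ.+-identityʳ i)) (sym (ℕₚ.+-identityʳ acc)) ⟩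
    factor l (i ℕ.+ 0) (acc ℕ.+ 0) y       ≡⟨ sym (ℚₚ.*-identityˡ _) ⟩
    1ℚ * factor l (i ℕ.+ 0) (acc ℕ.+ 0) y  ∎
  prodTerms-∷ʳ l acc i (x ∷ τ) y = begin
    f * prodTerms q l (acc ℕ.+ x) (suc i) (τ ++ [ y ])
      ≡⟨ cong (f *_) (prodTerms-∷ʳ l (acc ℕ.+ x) (suc i) τ y) ⟩
    f * (p * factor l (suc i ℕ.+ length τ) (acc ℕ.+ x ℕ.+ sum τ) y)
      ≡⟨ sym (ℚₚ.*-assoc f p _) ⟩
    (f * p) * factor l (suc i ℕ.+ length τ) (acc ℕ.+ x ℕ.+ sum τ) y
      ≡⟨ cong₂ (λ j s → (f * p) * factor l j s y) (sym (ℕₚ.+-suc i (length τ))) (ℕₚ.+-assoc acc x (sum τ)) ⟩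
    (f * p) * factor l (i ℕ.+ suc (length τ)) (acc ℕ.+ (x ℕ.+ sum τ)) y ∎
    where f = factor l i acc x; p = prodTerms q l (acc ℕ.+ x) (suc i) τ

  -- term k c = ∏ᵢ (1 - q ^ ((k + l - i + 1) cᵢ)) / (1 - q ^ [cᵢ]) with l = length c; term 0 is the summand of the theorem.
  term : ℕ → List ℕ → ℚ
  term k c = prodTerms q (k ℕ.+ length c) 0 0 c

  term-∷ʳ : ∀ k τ y → term k (τ ++ [ y ]) ≡ term (suc k) τ * ((1ℚ - q ^ (suc k ℕ.* y)) /' (1ℚ - q ^ (sum τ ℕ.+ y)))
  term-∷ʳ k τ y = begin
    prodTerms q (k ℕ.+ length (τ ++ [ y ])) 0 0 (τ ++ [ y ])
      ≡⟨ cong (λ l → prodTerms q l 0 0 (τ ++ [ y ])) k+l≡ ⟩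
    prodTerms q (suc k ℕ.+ length τ) 0 0 (τ ++ [ y ])
      ≡⟨ prodTerms-∷ʳ (suc k ℕ.+ length τ) 0 0 τ y ⟩
    term (suc k) τ * factor (suc k ℕ.+ length τ) (length τ) (sum τ) y
      ≡⟨ cong (λ m → term (suc k) τ * ((1ℚ - q ^ (m ℕ.* y)) /' (1ℚ - q ^ (sum τ ℕ.+ y)))) (ℕₚ.m+n∸n≡m (suc k) (length τ)) ⟩
    term (suc k) τ * ((1ℚ - q ^ (suc k ℕ.* y)) /' (1ℚ - q ^ (sum τ ℕ.+ y))) ∎
    where
    k+l≡ : k ℕ.+ length (τ ++ [ y ]) ≡ suc k ℕ.+ length τ
    k+l≡ = trans (cong (k ℕ.+_) (trans (length-++ τ) (ℕₚ.+-comm (length τ) 1))) (ℕₚ.+-suc k (length τ))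

  chainSum-recurrence : ∀ k x xs → let S = x ∷ xs in
    (1ℚ - q ^ sum S) * ∑ (chainSum k) (perms S) ≡ ∑ (uncurry λ y r → (1ℚ - q ^ (suc k ℕ.* y)) * ∑ (chainSum (suc k)) (perms r)) (picks S)
  chainSum-recurrence k x xs = begin
    (1ℚ - Y) * E
      ≡⟨ solve 4 (λ Y E U V → (con 1ℚ :- Y) :* E := (U :- V) :+ ((E :+ V) :- (U :+ Y :* E))) refl Y E U V ⟩
    (U - V) + ((E + V) - (U + Y * E))
      ≡⟨ cong ((U - V) +_) (trans (cong₂ _-_ (sym by-head) (sym by-last)) (ℚₚ.+-inverseʳ E′)) ⟩
    (U - V) + 0ℚ
      ≡⟨ ℚₚ.+-identityʳ (U - V) ⟩
    U - V
      ≡⟨ sym (∑-- (λ p → E′[ proj₂ p ]) (λ p → q ^ (suc k ℕ.* proj₁ p) * E′[ proj₂ p ]) (picks S)) ⟩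
    ∑ (uncurry λ y r → E′[ r ] - q ^ (suc k ℕ.* y) * E′[ r ]) (picks S)
      ≡⟨ ∑-cong (λ p → solve 2 (λ a e → e :- a :* e := (con 1ℚ :- a) :* e) refl (q ^ (suc k ℕ.* proj₁ p)) E′[ proj₂ p ]) (picks S) ⟩
    ∑ (uncurry λ y r → (1ℚ - q ^ (suc k ℕ.* y)) * E′[ r ]) (picks S) ∎
    where
    S = x ∷ xs
    E′[_] : List ℕ → ℚ
    E′[ r ] = ∑ (chainSum (suc k)) (perms r)
    Y = q ^ sum S
    E = ∑ (chainSum k) (perms S)
    E′ = E′[ S ]
    U = ∑-picks (λ _ → chainSum (suc k)) S
    V = ∑ (uncurry λ y r → q ^ (suc k ℕ.* y) * E′[ r ]) (picks S)
    by-last : E′ ≡ U + Y * E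
    by-last = begin
      E′
        ≡⟨ ∑-perms-last (chainSum (suc k)) x xs ⟩
      ∑-picks (λ y τ → chainSum (suc k) (τ ++ [ y ])) S
        ≡⟨ ∑-picks-cong S (λ {y} {r} {τ} yr↭S τ↭r → trans (chainSum-∷ʳ k τ y)
             (cong (λ n → chainSum (suc k) τ + q ^ n * chainSum k (τ ++ [ y ])) (sum-∷ʳ-↭ τ↭r yr↭S))) ⟩
      ∑-picks (λ y τ → chainSum (suc k) τ + Y * chainSum k (τ ++ [ y ])) S
        ≡⟨ ∑-picks-+ (λ _ → chainSum (suc k)) (λ y τ → Y * chainSum k (τ ++ [ y ])) S ⟩
      U + ∑-picks (λ y τ → Y * chainSum k (τ ++ [ y ])) S
        ≡⟨ cong (U +_) (trans (∑-picks-*ˡ (λ _ → Y) (λ y τ → chainSum k (τ ++ [ y ])) S) (∑-*ˡ Y _ (picks S))) ⟩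
      U + Y * ∑-picks (λ y τ → chainSum k (τ ++ [ y ])) S
        ≡⟨ cong (λ w → U + Y * w) (sym (∑-perms-last (chainSum k) x xs)) ⟩
      U + Y * E ∎
    by-head : E′ ≡ E + V
    by-head = begin
      E′
        ≡⟨ ∑-perms-head (chainSum (suc k)) x xs ⟩
      ∑-picks (λ y τ → chainSum k (y ∷ τ) + q ^ (suc k ℕ.* y) * chainSum (suc k) τ) S
        ≡⟨ ∑-picks-+ (λ y τ → chainSum k (y ∷ τ)) (λ y τ → q ^ (suc k ℕ.* y) * chainSum (suc k) τ) S ⟩
      ∑-picks (λ y τ → chainSum k (y ∷ τ)) S + ∑-picks (λ y τ → q ^ (suc k ℕ.* y) * chainSum (suc k) τ) S
        ≡⟨ cong₂ _+_ (sym (∑-perms-head (chainSum k) x xs)) (∑-picks-*ˡ (λ y → q ^ (suc k ℕ.* y)) (λ _ → chainSum (suc k)) S) ⟩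
      E + V ∎

  ∑-term≡∑-chainSum : (∀ n → 1ℚ - q ^ suc n ≢ 0ℚ) → ∀ k S → All (1 ≤_) S → ∑ (term k) (perms S) ≡ ∑ (chainSum k) (perms S)
  ∑-term≡∑-chainSum 1-qⁿ⁺¹≢0 k S S⁺ = go (length S) k S refl S⁺
    where
    go : ∀ n k S → length S ≡ n → All (1 ≤_) S → ∑ (term k) (perms S) ≡ ∑ (chainSum k) (perms S)
    go n       zero    []              _   _                 = refl
    go n       (suc k) []              _   _                 = refl
    go (suc n) k       S@(suc x ∷ xs) len S⁺@(s≤s z≤n ∷ _) = begin
      ∑ (term k) (perms S)
        ≡⟨ ∑-perms-last (term k) (suc x) xs ⟩
      ∑-picks (λ y τ → term k (τ ++ [ y ])) S
        ≡⟨ ∑-picks-cong S (λ {y} {r} {τ} yr↭S τ↭r → trans (term-∷ʳ k τ y)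
             (trans (cong (λ m → term (suc k) τ * (c y /' (1ℚ - q ^ m))) (sum-∷ʳ-↭ τ↭r yr↭S))
                    (ℚₚ.*-comm (term (suc k) τ) (c y /' D)))) ⟩
      ∑-picks (λ y τ → (c y /' D) * term (suc k) τ) S
        ≡⟨ ∑-picks-*ˡ (λ y → c y /' D) (λ _ → term (suc k)) S ⟩
      ∑ (uncurry λ y r → (c y /' D) * ∑ (term (suc k)) (perms r)) (picks S)
        ≡⟨ ∑-cong-local (All.map (λ {p} yr↭S → cong ((c (proj₁ p) /' D) *_) (induction yr↭S)) (picks-↭ S)) ⟩
      ∑ (uncurry λ y r → (c y /' D) * E′[ r ]) (picks S)
        ≡⟨ ∑-cong (λ p → /'-*-comm (c (proj₁ p)) D E′[ proj₂ p ]) (picks S) ⟩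
      ∑ (uncurry λ y r → (c y * E′[ r ]) /' D) (picks S)
        ≡⟨ ∑-/' (uncurry λ y r → c y * E′[ r ]) D (picks S) ⟩
      ∑ (uncurry λ y r → c y * E′[ r ]) (picks S) /' D
        ≡⟨ cong (_/' D) (sym (chainSum-recurrence k (suc x) xs)) ⟩
      (D * ∑ (chainSum k) (perms S)) /' D
        ≡⟨ *-/'-cancelˡ (∑ (chainSum k) (perms S)) (1-qⁿ⁺¹≢0 (x ℕ.+ sum xs)) ⟩
      ∑ (chainSum k) (perms S) ∎
      where
      c : ℕ → ℚ
      c y = 1ℚ - q ^ (suc k ℕ.* y)
      D = 1ℚ - q ^ sum S
      E′[_] : List ℕ → ℚ
      E′[ r ] = ∑ (chainSum (suc k)) (perms r)
      induction : ∀ {y r} → y ∷ r ↭ S → ∑ (term (suc k)) (perms r) ≡ E′[ r ]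
      induction {r = r} yr↭S with All-resp-↭ (↭-sym yr↭S) S⁺
      ... | _ ∷ r⁺ = go n (suc k) r (ℕₚ.suc-injective (trans (↭-length yr↭S) len)) r⁺

proposition5 : (μ : List ℕ) → IsPartition μ → 1 ≤ length μ →
    (q : ℚ) → (∀ n → 1ℚ - q ^ suc n ≢ 0ℚ) →
    LHS q μ ≡ RHS μ
proposition5 μ (μ⁺ , _) _ q 1-qⁿ⁺¹≢0 = sym (begin
  toℚ (length μ !) /' N  ≡⟨ cong (_/' N) (sym N*LHS≡l!) ⟩
  (N * LHS q μ) /' N     ≡⟨ *-/'-cancelˡ (LHS q μ) (toℚ-≢0 (prodMultFact μ) {{multFactorials-nonZero (upTo (suc (sum μ))) μ}}) ⟩
  LHS q μ                ∎)
  where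
  N = toℚ (prodMultFact μ)
  summand≡term : ∀ {c} → c ↭ μ → prodTerms q (length μ) 0 0 c ≡ term q 0 c
  summand≡term {c} c↭μ = cong (λ l → prodTerms q l 0 0 c) (sym (↭-length c↭μ))
  N*LHS≡l! : N * LHS q μ ≡ toℚ (length μ !)
  N*LHS≡l! = begin
    N * ∑ (prodTerms q (length μ) 0 0) (C μ)  ≡⟨ sym (∑-perms≡prodMultFact*∑-C _ μ) ⟩
    ∑ (prodTerms q (length μ) 0 0) (perms μ)  ≡⟨ ∑-cong-local (All.map summand≡term (perms-↭ μ)) ⟩
    ∑ (term q 0) (perms μ)                    ≡⟨ ∑-term≡∑-chainSum q 1-qⁿ⁺¹≢0 0 μ μ⁺ ⟩
    ∑ (chainSum q 0) (perms μ)                ≡⟨ ∑-1-perms μ ⟩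
    toℚ (length μ !)                          ∎
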